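{- Let $Z\subset\{0,1\}^n$ be a linear code of length $n=2p-1$ and size $N$, and let $Z^{\mathrm{ex}}\subset\{0,1\}^{n+1}$ be its extended code, obtained by appending to each $z=(z_1,\dots,z_n)\in Z$ the coordinate $z_{n+1}=z_1\oplus\cdots\oplus z_n$. Then $$D^{L_2}(Z^{\mathrm{ex}})=2D^{L_2}(Z)+\frac1{2^{n+1}}\binom{2n}{n},$$ where $D^{L_2}(Z)$ is computed in $\{0,1\}^n$ and $D^{L_2}(Z^{\mathrm{ex}})$ in $\{0,1\}^{n+1}$.
   Context: For a code $Z=\{z_1,\dots,z_N\}\subset\{0,1\}^m$ with Hamming distance $d$ and balls $B(x,t)=\{y:d(x,y)\le t\}$, $D^{L_2}(Z)=\sum_{t=0}^m\sum_{x\in\{0,1\}^m}\Big(\frac1N\sum_{j=1}^N\mathbb 1_{B(x,t)}(z_j)-\frac{|B(x,t)|}{2^m}\Big)^2$. A linear code is a linear subspace of $\mathbb F_2^n$. -}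

module Defs where

open import Data.Bool using (Bool; true; false; _xor_; if_then_else_)
open import Data.Nat as ℕ using (ℕ; zero; suc; _≤ᵇ_)
open import Data.Integer using (+_)
open import Data.List using (List; []; _∷_; map; _++_; foldr; upTo; filterᵇ; length)
open import Data.Vec using (Vec; []; _∷_; _∷ʳ_; replicate; zipWith)
open import Data.Rational using (ℚ; _+_; _-_; _*_; _/_; 0ℚ)
open import Relation.Binary.PropositionalEquality using (_≡_)

allVecs : (m : ℕ) → List (Vec Bool m)
allVecs zero = [] ∷ []
allVecs (suc m) = map (false ∷_) (allVecs m) ++ map (true ∷_) (allVecs m)

hamming : ∀ {m} → Vec Bool m → Vec Bool m → ℕ
hamming [] [] = 0
hamming (a ∷ x) (b ∷ y) = (if a xor b then 1 else 0) ℕ.+ hamming x y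

inBall : ∀ {m} → Vec Bool m → ℕ → Vec Bool m → Bool
inBall x t y = hamming x y ≤ᵇ t

ballSize : ∀ {m} → Vec Bool m → ℕ → ℕ
ballSize {m} x t = length (filterᵇ (inBall x t) (allVecs m))

-- a / b as a rational (b = 0 never occurs in the uses below).
frac : ℕ → ℕ → ℚ
frac a zero = 0ℚ
frac a (suc b) = (+ a) / suc b

sumℚ : List ℚ → ℚ
sumℚ = foldr _+_ 0ℚ

-- D^{L_2}(Z) for a code Z ⊆ {0,1}^m given as the list of its (distinct) codewords z_1..z_N.
DL2 : ∀ {m} → List (Vec Bool m) → ℚ
DL2 {m} Z = sumℚ (map (λ t → sumℚ (map (λ x → sq (term x t)) (allVecs m))) (upTo (suc m)))
  where
  N = length Z
  sq : ℚ → ℚ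
  sq q = q * q
  term : Vec Bool m → ℕ → ℚ
  term x t = frac (length (filterᵇ (inBall x t) Z)) N - frac (ballSize x t) (2 ℕ.^ m)

_⊕_ : ∀ {m} → Vec Bool m → Vec Bool m → Vec Bool m
_⊕_ = zipWith _xor_

-- A linear code (linear subspace of F_2^m), given by its characteristic function:
-- contains 0 and is closed under addition (the only scalars are 0 and 1).
record IsLinearCode {m : ℕ} (C : Vec Bool m → Bool) : Set where
  field
    has-zero : C (replicate m false) ≡ true
    closed-+ : ∀ x y → C x ≡ true → C y ≡ true → C (x ⊕ y) ≡ true

codewords : ∀ {m} → (Vec Bool m → Bool) → List (Vec Bool m)
codewords {m} C = filterᵇ C (allVecs m)

parity : ∀ {m} → Vec Bool m → Bool
parity [] = false
parity (a ∷ x) = a xor parity x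

extend : ∀ {m} → Vec Bool m → Vec Bool (suc m)
extend z = z ∷ʳ parity z

extendedCode : ∀ {m} → List (Vec Bool m) → List (Vec Bool (suc m))
extendedCode = map extend

module Submission where

-- Write N = |L|, M = 2^m, V_m(t) = |B(x,t)| and c_L(x,t) = |L ∩ B(x,t)|.  Expanding the square
-- in D^{L_2} and using Σ_x c_L(x,t) = N V_m(t) gives the closed form
--   D^{L_2}(L) = S(L)/N² − R_m/M,   S(L) = Σ_t Σ_x c_L(x,t)²,   R_m = Σ_t V_m(t)².
-- Both S and R are governed by the pair kernel P(z,z′) = Σ_x (m + 1 − max(d(x,z), d(x,z′))),
-- for S(L) = Σ_{z,z′ ∈ L} P(z,z′).  Splitting x ∈ {0,1}^{m+1} by its last bit yields
--   P(za, z′a′) + [a ≠ a′] E(z,z′) = 2 P(z,z′) + M,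
-- where E(z,z′) counts the points equidistant from z and z′.  For parity-extended words the
-- correction vanishes (equal distances force equal parities), so S(L^ex) = 2 S(L) + N² M.
-- Summing the same identity over the whole cube, with Σ_{y,y′} E(y,y′) = M C(2m,m), gives the
-- ball-volume relation R_{m+1} + C(2m,m) = 4 R_m + 2 M².  The theorem is the rational
-- combination of the two relations.

open import Defs
open import Data.Bool using (Bool; true; false; not; _∧_; _xor_; if_then_else_; T)
open import Data.Bool.Properties
  using (xor-same; not-distribˡ-xor; not-distribʳ-xor; xor-annihilates-not; xor-comm; not-injective; ∧-zeroʳ)
open import Data.Nat using (ℕ; zero; suc; _+_; _*_; _∸_; _^_; _≤_; _⊔_; _≤ᵇ_; _≡ᵇ_; z≤n; NonZero; >-nonZero)
import Data.Nat.Properties as ℕP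
open import Data.Nat.Combinatorics using (_C_; nCk+nC[k+1]≡[n+1]C[k+1])
open import Data.Nat.ListAction using (sum)
open import Data.Nat.ListAction.Properties using (sum-++)
open import Data.Nat.Tactic.RingSolver using (solve-∀)
open import Algebra.Properties.CommutativeSemigroup ℕP.+-commutativeSemigroup
  using () renaming (interchange to +-interchange; x∙yz≈y∙xz to +-exchange)
open import Data.List using (List; []; _∷_; map; _++_; upTo; filterᵇ; length)
import Data.List.Properties as ListP
open import Data.Vec using (Vec; []; _∷_; _∷ʳ_; replicate) renaming (_++_ to _++ᵛ_)
open import Data.Unit using (tt)
import Data.Integer as ℤ
import Data.Integer.Properties as ℤP
open import Data.Rational using (ℚ; 0ℚ; 1ℚ; fromℚᵘ) renaming (_+_ to _+ℚ_; _*_ to _*ℚ_; _-_ to _-ℚ_)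
import Data.Rational.Properties as ℚP
open import Data.Rational.Unnormalised using (mkℚᵘ; *≡*) renaming (_+_ to _+ᵘ_; _*_ to _*ᵘ_)
import Data.Rational.Unnormalised.Properties as ℚᵘP
open import Tactic.RingSolver using () renaming (solve-∀ to solveℚ-∀)
open import Tactic.RingSolver.Core.AlmostCommutativeRing using (AlmostCommutativeRing; fromCommutativeRing)
open import Relation.Nullary.Decidable using (dec⇒maybe)
open import Function using (_∘_; id)
open import Relation.Binary.PropositionalEquality

-- ∑[ x ← xs ] f x is the sum of f over the list xs.  It binds tightly:
-- ∑[ x ← xs ] f x + g reads (∑[ x ← xs ] f x) + g.
infixr 10 ∑
∑ : {A : Set} → List A → (A → ℕ) → ℕ
∑ xs f = sum (map f xs)

syntax ∑ xs (λ x → f) = ∑[ x ← xs ] f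

∑-cong : ∀ {A : Set} (xs : List A) {f g : A → ℕ} → (∀ x → f x ≡ g x) → ∑ xs f ≡ ∑ xs g
∑-cong xs f≗g = cong sum (ListP.map-cong f≗g xs)

∑-++ : ∀ {A : Set} (xs ys : List A) (f : A → ℕ) → ∑ (xs ++ ys) f ≡ ∑ xs f + ∑ ys f
∑-++ xs ys f = trans (cong sum (ListP.map-++ f xs ys)) (sum-++ (map f xs) (map f ys))

∑-map : ∀ {A B : Set} (g : A → B) (xs : List A) (f : B → ℕ) → ∑ (map g xs) f ≡ ∑ xs (f ∘ g)
∑-map g xs f = cong sum (sym (ListP.map-∘ xs))

∑-zero : ∀ {A : Set} (xs : List A) → ∑[ x ← xs ] 0 ≡ 0
∑-zero [] = refl
∑-zero (x ∷ xs) = ∑-zero xs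

∑-const : ∀ {A : Set} (xs : List A) k → ∑[ x ← xs ] k ≡ length xs * k
∑-const [] k = refl
∑-const (x ∷ xs) k = cong (k +_) (∑-const xs k)

∑-+ : ∀ {A : Set} (xs : List A) (f g : A → ℕ) → ∑[ x ← xs ] (f x + g x) ≡ ∑ xs f + ∑ xs g
∑-+ [] f g = refl
∑-+ (x ∷ xs) f g = trans (cong (f x + g x +_) (∑-+ xs f g)) (+-interchange (f x) (g x) _ _)

∑-*ˡ : ∀ {A : Set} (xs : List A) k (f : A → ℕ) → ∑[ x ← xs ] (k * f x) ≡ k * ∑ xs f
∑-*ˡ [] k f = sym (ℕP.*-zeroʳ k)
∑-*ˡ (x ∷ xs) k f = trans (cong (k * f x +_) (∑-*ˡ xs k f)) (sym (ℕP.*-distribˡ-+ k (f x) _))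

∑-*ʳ : ∀ {A : Set} (xs : List A) k (f : A → ℕ) → ∑[ x ← xs ] (f x * k) ≡ ∑ xs f * k
∑-*ʳ xs k f = trans (∑-cong xs (λ x → ℕP.*-comm (f x) k)) (trans (∑-*ˡ xs k f) (ℕP.*-comm k _))

∑-swap : ∀ {A B : Set} (xs : List A) (ys : List B) (f : A → B → ℕ) →
  ∑[ x ← xs ] ∑[ y ← ys ] f x y ≡ ∑[ y ← ys ] ∑[ x ← xs ] f x y
∑-swap [] ys f = sym (∑-zero ys)
∑-swap (x ∷ xs) ys f =
  trans (cong (∑ ys (f x) +_) (∑-swap xs ys f)) (sym (∑-+ ys (f x) (λ y → ∑[ x′ ← xs ] f x′ y)))

∑₂-+ : ∀ {A B : Set} (xs : List A) (ys : List B) (f g : A → B → ℕ) →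
  ∑[ x ← xs ] ∑[ y ← ys ] (f x y + g x y) ≡ ∑[ x ← xs ] ∑[ y ← ys ] f x y + ∑[ x ← xs ] ∑[ y ← ys ] g x y
∑₂-+ xs ys f g = trans (∑-cong xs (λ x → ∑-+ ys (f x) (g x))) (∑-+ xs _ _)

∑₂-*ˡ : ∀ {A B : Set} (xs : List A) (ys : List B) k (f : A → B → ℕ) →
  ∑[ x ← xs ] ∑[ y ← ys ] (k * f x y) ≡ k * ∑[ x ← xs ] ∑[ y ← ys ] f x y
∑₂-*ˡ xs ys k f = trans (∑-cong xs (λ x → ∑-*ˡ ys k (f x))) (∑-*ˡ xs k _)

∑-square : ∀ {A : Set} (xs : List A) (f : A → ℕ) → ∑ xs f * ∑ xs f ≡ ∑[ x ← xs ] ∑[ y ← xs ] (f x * f y)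
∑-square xs f = trans (sym (∑-*ʳ xs (∑ xs f) f)) (∑-cong xs (λ x → sym (∑-*ˡ xs (f x) f)))

∑-into-pairs : ∀ {A B : Set} (as : List A) (zs : List B) (f : A → B → B → ℕ) →
  ∑[ a ← as ] ∑[ z ← zs ] ∑[ z′ ← zs ] f a z z′ ≡ ∑[ z ← zs ] ∑[ z′ ← zs ] ∑[ a ← as ] f a z z′
∑-into-pairs as zs f =
  trans (∑-swap as zs (λ a z → ∑[ z′ ← zs ] f a z z′)) (∑-cong zs (λ z → ∑-swap as zs (λ a z′ → f a z z′)))

∑-upTo-suc : ∀ k (f : ℕ → ℕ) → ∑ (upTo (suc k)) f ≡ f 0 + ∑[ t ← upTo k ] f (suc t)
∑-upTo-suc k f =
  cong (f 0 +_) (cong sum (trans (ListP.map-applyUpTo suc f k) (sym (ListP.map-applyUpTo id (f ∘ suc) k))))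

𝟙 : Bool → ℕ
𝟙 b = if b then 1 else 0

length-filter : ∀ {A : Set} (p : A → Bool) (xs : List A) → length (filterᵇ p xs) ≡ ∑[ x ← xs ] 𝟙 (p x)
length-filter p [] = refl
length-filter p (x ∷ xs) with p x
... | true = cong suc (length-filter p xs)
... | false = length-filter p xs

cube-size : ∀ m → length (allVecs m) ≡ 2 ^ m
cube-size zero = refl
cube-size (suc m) = trans (ListP.length-++ (map (false ∷_) (allVecs m)))
  (cong₂ _+_ (trans (ListP.length-map _ (allVecs m)) (cube-size m))
             (trans (ListP.length-map _ (allVecs m)) (trans (cube-size m) (sym (ℕP.+-identityʳ _)))))

∑-cube-const : ∀ m k → ∑[ y ← allVecs m ] k ≡ 2 ^ m * k
∑-cube-const m k = trans (∑-const (allVecs m) k) (cong (_* k) (cube-size m))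

∑-cube-head : ∀ m (F : Vec Bool (suc m) → ℕ) →
  ∑ (allVecs (suc m)) F ≡ ∑[ y ← allVecs m ] F (false ∷ y) + ∑[ y ← allVecs m ] F (true ∷ y)
∑-cube-head m F =
  trans (∑-++ (map (false ∷_) (allVecs m)) _ F) (cong₂ _+_ (∑-map _ (allVecs m) F) (∑-map _ (allVecs m) F))

∑-cube-last : ∀ m (F : Vec Bool (suc m) → ℕ) →
  ∑ (allVecs (suc m)) F ≡ ∑[ x ← allVecs m ] (F (x ∷ʳ false) + F (x ∷ʳ true))
∑-cube-last zero F = sym (ℕP.+-assoc (F (false ∷ [])) _ 0)
∑-cube-last (suc m) F = begin
    ∑ (allVecs (suc (suc m))) F
  ≡⟨ ∑-cube-head (suc m) F ⟩
    ∑[ y ← allVecs (suc m) ] F (false ∷ y) + ∑[ y ← allVecs (suc m) ] F (true ∷ y)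
  ≡⟨ cong₂ _+_ (∑-cube-last m (λ y → F (false ∷ y))) (∑-cube-last m (λ y → F (true ∷ y))) ⟩
    ∑[ x ← allVecs m ] (F (false ∷ (x ∷ʳ false)) + F (false ∷ (x ∷ʳ true)))
      + ∑[ x ← allVecs m ] (F (true ∷ (x ∷ʳ false)) + F (true ∷ (x ∷ʳ true)))
  ≡⟨ ∑-cube-head m (λ x → F (x ∷ʳ false) + F (x ∷ʳ true)) ⟨
    ∑[ x ← allVecs (suc m) ] (F (x ∷ʳ false) + F (x ∷ʳ true))
  ∎
  where open ≡-Reasoning

∑-cube-last₂ : ∀ m (F : Vec Bool (suc m) → Vec Bool (suc m) → ℕ) →
  ∑[ w ← allVecs (suc m) ] ∑[ w′ ← allVecs (suc m) ] F w w′
    ≡ ∑[ y ← allVecs m ] ∑[ y′ ← allVecs m ]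
        ((F (y ∷ʳ false) (y′ ∷ʳ false) + F (y ∷ʳ false) (y′ ∷ʳ true))
          + (F (y ∷ʳ true) (y′ ∷ʳ false) + F (y ∷ʳ true) (y′ ∷ʳ true)))
∑-cube-last₂ m F = trans (∑-cube-last m _) (∑-cong (allVecs m) (λ y →
  trans (cong₂ _+_ (∑-cube-last m (F (y ∷ʳ false))) (∑-cube-last m (F (y ∷ʳ true)))) (sym (∑-+ (allVecs m) _ _))))

∑-cube-translate : ∀ m (x : Vec Bool m) (F : Vec Bool m → ℕ) → ∑[ y ← allVecs m ] F (x ⊕ y) ≡ ∑ (allVecs m) F
∑-cube-translate zero [] F = refl
∑-cube-translate (suc m) (false ∷ x) F = begin
    ∑[ y ← allVecs (suc m) ] F ((false ∷ x) ⊕ y)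
  ≡⟨ ∑-cube-head m (λ y → F ((false ∷ x) ⊕ y)) ⟩
    ∑[ y ← allVecs m ] F (false ∷ x ⊕ y) + ∑[ y ← allVecs m ] F (true ∷ x ⊕ y)
  ≡⟨ cong₂ _+_ (∑-cube-translate m x (F ∘ (false ∷_))) (∑-cube-translate m x (F ∘ (true ∷_))) ⟩
    ∑[ y ← allVecs m ] F (false ∷ y) + ∑[ y ← allVecs m ] F (true ∷ y)
  ≡⟨ ∑-cube-head m F ⟨
    ∑ (allVecs (suc m)) F
  ∎
  where open ≡-Reasoning
∑-cube-translate (suc m) (true ∷ x) F = begin
    ∑[ y ← allVecs (suc m) ] F ((true ∷ x) ⊕ y)
  ≡⟨ ∑-cube-head m (λ y → F ((true ∷ x) ⊕ y)) ⟩
    ∑[ y ← allVecs m ] F (true ∷ x ⊕ y) + ∑[ y ← allVecs m ] F (false ∷ x ⊕ y)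
  ≡⟨ cong₂ _+_ (∑-cube-translate m x (F ∘ (true ∷_))) (∑-cube-translate m x (F ∘ (false ∷_))) ⟩
    ∑[ y ← allVecs m ] F (true ∷ y) + ∑[ y ← allVecs m ] F (false ∷ y)
  ≡⟨ ℕP.+-comm (∑[ y ← allVecs m ] F (true ∷ y)) _ ⟩
    ∑[ y ← allVecs m ] F (false ∷ y) + ∑[ y ← allVecs m ] F (true ∷ y)
  ≡⟨ ∑-cube-head m F ⟨
    ∑ (allVecs (suc m)) F
  ∎
  where open ≡-Reasoning

∑-cube-++ : ∀ a b (F : Vec Bool (a + b) → ℕ) →
  ∑ (allVecs (a + b)) F ≡ ∑[ y ← allVecs a ] ∑[ y′ ← allVecs b ] F (y ++ᵛ y′)
∑-cube-++ zero b F = sym (ℕP.+-identityʳ _)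
∑-cube-++ (suc a) b F = trans (∑-cube-head (a + b) F)
  (trans (cong₂ _+_ (∑-cube-++ a b (F ∘ (false ∷_))) (∑-cube-++ a b (F ∘ (true ∷_))))
    (sym (∑-cube-head a _)))

term≤∑-cube : ∀ {m} (v : Vec Bool m) (F : Vec Bool m → ℕ) → F v ≤ ∑ (allVecs m) F
term≤∑-cube [] F = ℕP.m≤m+n (F []) 0
term≤∑-cube {suc m} (false ∷ v) F = ℕP.≤-trans (term≤∑-cube v (F ∘ (false ∷_)))
  (ℕP.≤-trans (ℕP.m≤m+n _ _) (ℕP.≤-reflexive (sym (∑-cube-head m F))))
term≤∑-cube {suc m} (true ∷ v) F = ℕP.≤-trans (term≤∑-cube v (F ∘ (true ∷_)))
  (ℕP.≤-trans (ℕP.m≤n+m _ _) (ℕP.≤-reflexive (sym (∑-cube-head m F))))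

weight : ∀ {m} → Vec Bool m → ℕ
weight [] = 0
weight (b ∷ y) = 𝟙 b + weight y

hamming≡weight : ∀ {m} (x y : Vec Bool m) → hamming x y ≡ weight (x ⊕ y)
hamming≡weight [] [] = refl
hamming≡weight (a ∷ x) (b ∷ y) = cong (𝟙 (a xor b) +_) (hamming≡weight x y)

hamming-sym : ∀ {m} (x y : Vec Bool m) → hamming x y ≡ hamming y x
hamming-sym [] [] = refl
hamming-sym (a ∷ x) (b ∷ y) = cong₂ _+_ (cong 𝟙 (xor-comm a b)) (hamming-sym x y)

𝟙≤1 : ∀ b → 𝟙 b ≤ 1
𝟙≤1 false = z≤n
𝟙≤1 true = ℕP.≤-refl

hamming≤length : ∀ {m} (x y : Vec Bool m) → hamming x y ≤ m
hamming≤length [] [] = z≤n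
hamming≤length (a ∷ x) (b ∷ y) = ℕP.+-mono-≤ (𝟙≤1 (a xor b)) (hamming≤length x y)

hamming-∷ʳ : ∀ {m} (x z : Vec Bool m) b a → hamming (x ∷ʳ b) (z ∷ʳ a) ≡ 𝟙 (b xor a) + hamming x z
hamming-∷ʳ [] [] b a = refl
hamming-∷ʳ (c ∷ x) (e ∷ z) b a =
  trans (cong (𝟙 (c xor e) +_) (hamming-∷ʳ x z b a)) (+-exchange (𝟙 (c xor e)) (𝟙 (b xor a)) _)

volume : ℕ → ℕ → ℕ
volume m t = ∑[ y ← allVecs m ] 𝟙 (weight y ≤ᵇ t)

ballSize≡volume : ∀ {m} (x : Vec Bool m) t → ballSize x t ≡ volume m t
ballSize≡volume {m} x t = begin
    ballSize x t
  ≡⟨ length-filter (inBall x t) (allVecs m) ⟩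
    ∑[ y ← allVecs m ] 𝟙 (hamming x y ≤ᵇ t)
  ≡⟨ ∑-cong (allVecs m) (λ y → cong (λ d → 𝟙 (d ≤ᵇ t)) (hamming≡weight x y)) ⟩
    ∑[ y ← allVecs m ] 𝟙 (weight (x ⊕ y) ≤ᵇ t)
  ≡⟨ ∑-cube-translate m x (λ y → 𝟙 (weight y ≤ᵇ t)) ⟩
    volume m t
  ∎
  where open ≡-Reasoning

isOdd : ℕ → Bool
isOdd zero = false
isOdd (suc n) = not (isOdd n)

isOdd-weight : ∀ {m} (y : Vec Bool m) → isOdd (weight y) ≡ parity y
isOdd-weight [] = refl
isOdd-weight (false ∷ y) = isOdd-weight y
isOdd-weight (true ∷ y) = cong not (isOdd-weight y)

xor-interchange : ∀ a b c d → (a xor b) xor (c xor d) ≡ (a xor c) xor (b xor d)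
xor-interchange false false c d = refl
xor-interchange false true c d = not-distribʳ-xor c d
xor-interchange true false c d = not-distribˡ-xor c d
xor-interchange true true c d = sym (xor-annihilates-not c d)

xor-cancelˡ : ∀ c {a b} → c xor a ≡ c xor b → a ≡ b
xor-cancelˡ false e = e
xor-cancelˡ true e = not-injective e

parity-⊕ : ∀ {m} (x z : Vec Bool m) → parity (x ⊕ z) ≡ parity x xor parity z
parity-⊕ [] [] = refl
parity-⊕ (a ∷ x) (b ∷ z) =
  trans (cong ((a xor b) xor_) (parity-⊕ x z)) (xor-interchange a b (parity x) (parity z))

isOdd-hamming : ∀ {m} (x z : Vec Bool m) → isOdd (hamming x z) ≡ parity x xor parity z
isOdd-hamming x z = trans (cong isOdd (hamming≡weight x z)) (trans (isOdd-weight (x ⊕ z)) (parity-⊕ x z))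

equidistant⇒same-parity : ∀ {m} (x z z′ : Vec Bool m) → hamming x z ≡ hamming x z′ → parity z ≡ parity z′
equidistant⇒same-parity x z z′ e =
  xor-cancelˡ (parity x) (trans (sym (isOdd-hamming x z)) (trans (cong isOdd e) (isOdd-hamming x z′)))

no-parity-tie : ∀ {m} (x z z′ : Vec Bool m) → ((parity z xor parity z′) ∧ (hamming x z ≡ᵇ hamming x z′)) ≡ false
no-parity-tie x z z′ with hamming x z ≡ᵇ hamming x z′ in tie
... | false = ∧-zeroʳ (parity z xor parity z′)
... | true = trans (cong (λ p → (p xor parity z′) ∧ true) same-parity) (cong (_∧ true) (xor-same (parity z′)))
  where
  same-parity : parity z ≡ parity z′
  same-parity = equidistant⇒same-parity x z z′ (ℕP.≡ᵇ⇒≡ _ _ (subst T (sym tie) tt))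

-- Pairs of words of equal weight: the central binomial coefficient

weight-count : ∀ m j → ∑[ y ← allVecs m ] 𝟙 (weight y ≡ᵇ j) ≡ m C j
weight-count zero zero = refl
weight-count zero (suc j) = refl
weight-count (suc m) zero = trans (∑-cube-head m (λ y → 𝟙 (weight y ≡ᵇ 0)))
  (cong₂ _+_ (weight-count m 0) (∑-zero (allVecs m)))
weight-count (suc m) (suc j) = trans (∑-cube-head m (λ y → 𝟙 (weight y ≡ᵇ suc j)))
  (trans (cong₂ _+_ (weight-count m (suc j)) (weight-count m j))
    (trans (ℕP.+-comm (m C suc j) (m C j)) (nCk+nC[k+1]≡[n+1]C[k+1] m j)))

weight-++ : ∀ {a b} (y : Vec Bool a) (y′ : Vec Bool b) → weight (y ++ᵛ y′) ≡ weight y + weight y′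
weight-++ [] y′ = refl
weight-++ (c ∷ y) y′ = trans (cong (𝟙 c +_) (weight-++ y y′)) (sym (ℕP.+-assoc (𝟙 c) _ _))

complement-weight : ∀ m (y : Vec Bool m) → weight (replicate m true ⊕ y) + weight y ≡ m
complement-weight zero [] = refl
complement-weight (suc m) (b ∷ y) =
  trans (+-interchange (𝟙 (not b)) (weight (replicate m true ⊕ y)) (𝟙 b) (weight y))
    (cong₂ _+_ (𝟙-not b) (complement-weight m y))
  where
  𝟙-not : ∀ b → 𝟙 (not b) + 𝟙 b ≡ 1
  𝟙-not false = refl
  𝟙-not true = refl

≡ᵇ-+ʳ : ∀ a k j → (a + j ≡ᵇ k + j) ≡ (a ≡ᵇ k)
≡ᵇ-+ʳ a k zero = cong₂ _≡ᵇ_ (ℕP.+-identityʳ a) (ℕP.+-identityʳ k)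
≡ᵇ-+ʳ a k (suc j) = trans (cong₂ _≡ᵇ_ (ℕP.+-suc a j) (ℕP.+-suc k j)) (≡ᵇ-+ʳ a k j)

-- |{(y,y′) : |y| = |y′|}| = C(2m,m): complementing y′ turns the condition into |y ++ y′| = m.
equal-weight-pairs : ∀ m → ∑[ y ← allVecs m ] ∑[ y′ ← allVecs m ] 𝟙 (weight y ≡ᵇ weight y′) ≡ (2 * m) C m
equal-weight-pairs m = begin
    ∑[ y ← allVecs m ] ∑[ y′ ← allVecs m ] 𝟙 (weight y ≡ᵇ weight y′)
  ≡⟨ ∑-cong (allVecs m) (λ y → sym (∑-cube-translate m 𝟏 (λ y′ → 𝟙 (weight y ≡ᵇ weight y′)))) ⟩
    ∑[ y ← allVecs m ] ∑[ y′ ← allVecs m ] 𝟙 (weight y ≡ᵇ weight (𝟏 ⊕ y′))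
  ≡⟨ ∑-cong (allVecs m) (λ y → ∑-cong (allVecs m) (complement-condition y)) ⟩
    ∑[ y ← allVecs m ] ∑[ y′ ← allVecs m ] 𝟙 (weight (y ++ᵛ y′) ≡ᵇ m)
  ≡⟨ ∑-cube-++ m m (λ w → 𝟙 (weight w ≡ᵇ m)) ⟨
    ∑[ w ← allVecs (m + m) ] 𝟙 (weight w ≡ᵇ m)
  ≡⟨ weight-count (m + m) m ⟩
    (m + m) C m
  ≡⟨ cong (λ k → (m + k) C m) (ℕP.+-identityʳ m) ⟨
    (2 * m) C m
  ∎
  where
  open ≡-Reasoning
  𝟏 : Vec Bool m
  𝟏 = replicate m true
  complement-condition : ∀ y y′ → 𝟙 (weight y ≡ᵇ weight (𝟏 ⊕ y′)) ≡ 𝟙 (weight (y ++ᵛ y′) ≡ᵇ m)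
  complement-condition y y′ = cong 𝟙 (trans (sym (≡ᵇ-+ʳ (weight y) (weight (𝟏 ⊕ y′)) (weight y′)))
    (cong₂ _≡ᵇ_ (sym (weight-++ y y′)) (complement-weight m y′)))

equidistant : ∀ {m} → Vec Bool m → Vec Bool m → ℕ
equidistant {m} z z′ = ∑[ x ← allVecs m ] 𝟙 (hamming x z ≡ᵇ hamming x z′)

-- Σ_{y,y′} E(y,y′) = 2^m C(2m,m): translating by x reduces each x to the equal-weight count.
∑-equidistant : ∀ m → ∑[ y ← allVecs m ] ∑[ y′ ← allVecs m ] equidistant y y′ ≡ 2 ^ m * ((2 * m) C m)
∑-equidistant m = begin
    ∑[ y ← allVecs m ] ∑[ y′ ← allVecs m ] equidistant y y′
  ≡⟨ ∑-into-pairs (allVecs m) (allVecs m) (λ x y y′ → 𝟙 (hamming x y ≡ᵇ hamming x y′)) ⟨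
    ∑[ x ← allVecs m ] ∑[ y ← allVecs m ] ∑[ y′ ← allVecs m ] 𝟙 (hamming x y ≡ᵇ hamming x y′)
  ≡⟨ ∑-cong (allVecs m) (λ x → trans (seen-from x) (equal-weight-pairs m)) ⟩
    ∑[ x ← allVecs m ] ((2 * m) C m)
  ≡⟨ ∑-cube-const m ((2 * m) C m) ⟩
    2 ^ m * ((2 * m) C m)
  ∎
  where
  open ≡-Reasoning
  seen-from : ∀ x → ∑[ y ← allVecs m ] ∑[ y′ ← allVecs m ] 𝟙 (hamming x y ≡ᵇ hamming x y′)
                  ≡ ∑[ y ← allVecs m ] ∑[ y′ ← allVecs m ] 𝟙 (weight y ≡ᵇ weight y′)
  seen-from x = trans
    (∑-cong (allVecs m) (λ y → trans
      (∑-cong (allVecs m) (λ y′ → cong₂ (λ d d′ → 𝟙 (d ≡ᵇ d′)) (hamming≡weight x y) (hamming≡weight x y′)))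
      (∑-cube-translate m x (λ y′ → 𝟙 (weight (x ⊕ y) ≡ᵇ weight y′)))))
    (∑-cube-translate m x (λ y → ∑[ y′ ← allVecs m ] 𝟙 (weight y ≡ᵇ weight y′)))

-- The pair kernel P(z,z′) = Σ_x Σ_{t ≤ m} [d(x,z) ≤ t][d(x,z′) ≤ t]

jointRadii : ∀ {m} → Vec Bool m → Vec Bool m → Vec Bool m → ℕ
jointRadii {m} z z′ x = ∑[ t ← upTo (suc m) ] (𝟙 (hamming x z ≤ᵇ t) * 𝟙 (hamming x z′ ≤ᵇ t))

pairKernel : ∀ {m} → Vec Bool m → Vec Bool m → ℕ
pairKernel {m} z z′ = ∑[ x ← allVecs m ] jointRadii z z′ x

≤ᵇ-suc : ∀ d t → (suc d ≤ᵇ suc t) ≡ (d ≤ᵇ t)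
≤ᵇ-suc zero t = refl
≤ᵇ-suc (suc d) t = refl

𝟙-≤ᵇ-⊔ : ∀ a b t → 𝟙 (a ≤ᵇ t) * 𝟙 (b ≤ᵇ t) ≡ 𝟙 (a ⊔ b ≤ᵇ t)
𝟙-≤ᵇ-⊔ zero b t = ℕP.+-identityʳ _
𝟙-≤ᵇ-⊔ (suc a) zero t = ℕP.*-identityʳ _
𝟙-≤ᵇ-⊔ (suc a) (suc b) zero = refl
𝟙-≤ᵇ-⊔ (suc a) (suc b) (suc t) =
  trans (cong₂ _*_ (cong 𝟙 (≤ᵇ-suc a t)) (cong 𝟙 (≤ᵇ-suc b t)))
    (trans (𝟙-≤ᵇ-⊔ a b t) (cong 𝟙 (sym (≤ᵇ-suc (a ⊔ b) t))))

radii-above : ∀ k d → ∑[ t ← upTo k ] 𝟙 (d ≤ᵇ t) ≡ k ∸ d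
radii-above zero d = sym (ℕP.0∸n≡0 d)
radii-above (suc k) zero = trans (∑-upTo-suc k (λ t → 𝟙 (0 ≤ᵇ t))) (cong suc (radii-above k zero))
radii-above (suc k) (suc d) = trans (∑-upTo-suc k (λ t → 𝟙 (suc d ≤ᵇ t)))
  (trans (∑-cong (upTo k) (λ t → cong 𝟙 (≤ᵇ-suc d t))) (radii-above k d))

jointRadii-complement : ∀ {m} (z z′ x : Vec Bool m) → jointRadii z z′ x + (hamming x z ⊔ hamming x z′) ≡ suc m
jointRadii-complement {m} z z′ x = begin
    jointRadii z z′ x + D
  ≡⟨ cong (_+ D) (∑-cong (upTo (suc m)) (𝟙-≤ᵇ-⊔ (hamming x z) (hamming x z′))) ⟩
    ∑[ t ← upTo (suc m) ] 𝟙 (D ≤ᵇ t) + D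
  ≡⟨ cong (_+ D) (radii-above (suc m) D) ⟩
    suc m ∸ D + D
  ≡⟨ ℕP.m∸n+n≡m (ℕP.m≤n⇒m≤1+n (ℕP.⊔-lub (hamming≤length x z) (hamming≤length x z′))) ⟩
    suc m
  ∎
  where
  open ≡-Reasoning
  D = hamming x z ⊔ hamming x z′

⊔-suc-sum : ∀ a b → (a ⊔ suc b) + (suc a ⊔ b) ≡ suc ((a ⊔ b) + (a ⊔ b) + 𝟙 (a ≡ᵇ b))
⊔-suc-sum zero zero = refl
⊔-suc-sum zero (suc b) = cong suc (sym (ℕP.+-identityʳ _))
⊔-suc-sum (suc a) zero = cong suc (trans (cong (_+ suc (suc a)) (ℕP.⊔-identityʳ a)) (shift a))
  where
  shift : ∀ a → a + suc (suc a) ≡ suc (a + suc a) + 0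
  shift = solve-∀
⊔-suc-sum (suc a) (suc b) = cong suc (begin
    (a ⊔ suc b) + suc (suc a ⊔ b)
  ≡⟨ ℕP.+-suc (a ⊔ suc b) (suc a ⊔ b) ⟩
    suc ((a ⊔ suc b) + (suc a ⊔ b))
  ≡⟨ cong suc (⊔-suc-sum a b) ⟩
    suc (suc (D + D + 𝟙 (a ≡ᵇ b)))
  ≡⟨ cong (λ n → suc (n + 𝟙 (a ≡ᵇ b))) (ℕP.+-suc D D) ⟨
    suc (D + suc D + 𝟙 (a ≡ᵇ b))
  ∎)
  where
  open ≡-Reasoning
  D = a ⊔ b

extended-maxima : ∀ a a′ d d′ →
  ((𝟙 a + d) ⊔ (𝟙 a′ + d′)) + ((𝟙 (not a) + d) ⊔ (𝟙 (not a′) + d′))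
    ≡ suc ((d ⊔ d′) + (d ⊔ d′) + 𝟙 ((a xor a′) ∧ (d ≡ᵇ d′)))
extended-maxima false false d d′ = trans (ℕP.+-suc (d ⊔ d′) (d ⊔ d′)) (cong suc (sym (ℕP.+-identityʳ _)))
extended-maxima false true d d′ = ⊔-suc-sum d d′
extended-maxima true false d d′ = trans (ℕP.+-comm (suc d ⊔ d′) (d ⊔ suc d′)) (⊔-suc-sum d d′)
extended-maxima true true d d′ = cong suc (sym (ℕP.+-identityʳ _))

complement-balance : ∀ {kf kt k A B D I m} →
  kf + A ≡ suc (suc m) → kt + B ≡ suc (suc m) → k + D ≡ suc m → A + B ≡ suc (D + D + I) →
  kf + kt + I ≡ 2 * k + 1
complement-balance {kf} {kt} {k} {A} {B} {D} {I} {m} hf ht h hAB = ℕP.+-cancelʳ-≡ (suc (D + D)) _ _ (begin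
    kf + kt + I + suc (D + D)   ≡⟨ gather kf kt I D ⟩
    kf + kt + suc (D + D + I)   ≡⟨ cong (kf + kt +_) hAB ⟨
    kf + kt + (A + B)           ≡⟨ +-interchange kf kt A B ⟩
    (kf + A) + (kt + B)         ≡⟨ cong₂ _+_ hf ht ⟩
    suc (suc m) + suc (suc m)   ≡⟨ cong (λ n → suc n + suc n) h ⟨
    suc (k + D) + suc (k + D)   ≡⟨ spread k D ⟩
    2 * k + 1 + suc (D + D)     ∎)
  where
  open ≡-Reasoning
  gather : ∀ kf kt I D → kf + kt + I + suc (D + D) ≡ kf + kt + suc (D + D + I)
  gather = solve-∀
  spread : ∀ k D → suc (k + D) + suc (k + D) ≡ 2 * k + 1 + suc (D + D)
  spread = solve-∀

jointRadii-extend : ∀ {m} (z z′ x : Vec Bool m) a a′ →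
  jointRadii (z ∷ʳ a) (z′ ∷ʳ a′) (x ∷ʳ false) + jointRadii (z ∷ʳ a) (z′ ∷ʳ a′) (x ∷ʳ true)
    + 𝟙 ((a xor a′) ∧ (hamming x z ≡ᵇ hamming x z′)) ≡ 2 * jointRadii z z′ x + 1
jointRadii-extend z z′ x a a′ =
  complement-balance {kf = Jf} {kt = Jt} {k = jointRadii z z′ x} {A = Af} {B = At} {D = hamming x z ⊔ hamming x z′}
    (jointRadii-complement (z ∷ʳ a) (z′ ∷ʳ a′) (x ∷ʳ false))
    (jointRadii-complement (z ∷ʳ a) (z′ ∷ʳ a′) (x ∷ʳ true))
    (jointRadii-complement z z′ x)
    (trans (cong₂ _+_ (cong₂ _⊔_ (hamming-∷ʳ x z false a) (hamming-∷ʳ x z′ false a′))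
                      (cong₂ _⊔_ (hamming-∷ʳ x z true a) (hamming-∷ʳ x z′ true a′)))
           (extended-maxima a a′ (hamming x z) (hamming x z′)))
  where
  Jf = jointRadii (z ∷ʳ a) (z′ ∷ʳ a′) (x ∷ʳ false)
  Jt = jointRadii (z ∷ʳ a) (z′ ∷ʳ a′) (x ∷ʳ true)
  Af = hamming (x ∷ʳ false) (z ∷ʳ a) ⊔ hamming (x ∷ʳ false) (z′ ∷ʳ a′)
  At = hamming (x ∷ʳ true) (z ∷ʳ a) ⊔ hamming (x ∷ʳ true) (z′ ∷ʳ a′)

pairKernel-extend : ∀ {m} (z z′ : Vec Bool m) a a′ →
  pairKernel (z ∷ʳ a) (z′ ∷ʳ a′) + ∑[ x ← allVecs m ] 𝟙 ((a xor a′) ∧ (hamming x z ≡ᵇ hamming x z′))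
    ≡ 2 * pairKernel z z′ + 2 ^ m
pairKernel-extend {m} z z′ a a′ = begin
    pairKernel (z ∷ʳ a) (z′ ∷ʳ a′) + ∑ (allVecs m) tie
  ≡⟨ cong (_+ ∑ (allVecs m) tie) (∑-cube-last m (jointRadii (z ∷ʳ a) (z′ ∷ʳ a′))) ⟩
    ∑[ x ← allVecs m ] (Jf x + Jt x) + ∑ (allVecs m) tie
  ≡⟨ ∑-+ (allVecs m) (λ x → Jf x + Jt x) tie ⟨
    ∑[ x ← allVecs m ] (Jf x + Jt x + tie x)
  ≡⟨ ∑-cong (allVecs m) (λ x → jointRadii-extend z z′ x a a′) ⟩
    ∑[ x ← allVecs m ] (2 * jointRadii z z′ x + 1)
  ≡⟨ ∑-+ (allVecs m) (λ x → 2 * jointRadii z z′ x) (λ _ → 1) ⟩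
    ∑[ x ← allVecs m ] (2 * jointRadii z z′ x) + ∑[ x ← allVecs m ] 1
  ≡⟨ cong₂ _+_ (∑-*ˡ (allVecs m) 2 (jointRadii z z′)) (trans (∑-cube-const m 1) (ℕP.*-identityʳ _)) ⟩
    2 * pairKernel z z′ + 2 ^ m
  ∎
  where
  open ≡-Reasoning
  tie = λ x → 𝟙 ((a xor a′) ∧ (hamming x z ≡ᵇ hamming x z′))
  Jf = λ x → jointRadii (z ∷ʳ a) (z′ ∷ʳ a′) (x ∷ʳ false)
  Jt = λ x → jointRadii (z ∷ʳ a) (z′ ∷ʳ a′) (x ∷ʳ true)

pairKernel-parity-extend : ∀ {m} (z z′ : Vec Bool m) → pairKernel (extend z) (extend z′) ≡ 2 * pairKernel z z′ + 2 ^ m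
pairKernel-parity-extend {m} z z′ = begin
    pairKernel (extend z) (extend z′)
  ≡⟨ ℕP.+-identityʳ _ ⟨
    pairKernel (extend z) (extend z′) + 0
  ≡⟨ cong (pairKernel (extend z) (extend z′) +_) no-ties ⟨
    pairKernel (extend z) (extend z′) + ∑[ x ← allVecs m ] 𝟙 ((parity z xor parity z′) ∧ (hamming x z ≡ᵇ hamming x z′))
  ≡⟨ pairKernel-extend z z′ (parity z) (parity z′) ⟩
    2 * pairKernel z z′ + 2 ^ m
  ∎
  where
  open ≡-Reasoning
  no-ties : ∑[ x ← allVecs m ] 𝟙 ((parity z xor parity z′) ∧ (hamming x z ≡ᵇ hamming x z′)) ≡ 0
  no-ties = trans (∑-cong (allVecs m) (λ x → cong 𝟙 (no-parity-tie x z z′))) (∑-zero (allVecs m))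

four-extensions : ∀ {m} (y y′ : Vec Bool m) →
  (pairKernel (y ∷ʳ false) (y′ ∷ʳ false) + pairKernel (y ∷ʳ false) (y′ ∷ʳ true))
    + (pairKernel (y ∷ʳ true) (y′ ∷ʳ false) + pairKernel (y ∷ʳ true) (y′ ∷ʳ true))
    + 2 * equidistant y y′
    ≡ 8 * pairKernel y y′ + 4 * 2 ^ m
four-extensions {m} y y′ = begin
    (P false false + P false true) + (P true false + P true true) + 2 * E
  ≡⟨ regroup (P false false) (P false true) (P true false) (P true true) E ⟩
    P false false + (P false true + E) + ((P true false + E) + P true true)
  ≡⟨ cong₂ (λ u v → u + v) (cong₂ _+_ (equal-bits false) (pairKernel-extend y y′ false true))
                           (cong₂ _+_ (pairKernel-extend y y′ true false) (equal-bits true)) ⟩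
    Q + Q + (Q + Q)
  ≡⟨ collect (pairKernel y y′) (2 ^ m) ⟩
    8 * pairKernel y y′ + 4 * 2 ^ m
  ∎
  where
  open ≡-Reasoning
  P : Bool → Bool → ℕ
  P a a′ = pairKernel (y ∷ʳ a) (y′ ∷ʳ a′)
  E = equidistant y y′
  Q = 2 * pairKernel y y′ + 2 ^ m
  equal-bits : ∀ a → P a a ≡ Q
  equal-bits a = trans (sym (ℕP.+-identityʳ _))
    (trans (cong (P a a +_) (sym (trans (∑-cong (allVecs m) (λ x → cong (λ b → 𝟙 (b ∧ _)) (xor-same a)))
                                          (∑-zero (allVecs m)))))
      (pairKernel-extend y y′ a a))
  regroup : ∀ a b c d e → (a + b) + (c + d) + 2 * e ≡ a + (b + e) + ((c + e) + d)
  regroup = solve-∀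
  collect : ∀ p M → (2 * p + M) + (2 * p + M) + ((2 * p + M) + (2 * p + M)) ≡ 8 * p + 4 * M
  collect = solve-∀

inBallCount : ∀ {m} → List (Vec Bool m) → Vec Bool m → ℕ → ℕ
inBallCount L x t = length (filterᵇ (inBall x t) L)

secondMoment : ∀ {m} → List (Vec Bool m) → ℕ
secondMoment {m} L = ∑[ t ← upTo (suc m) ] ∑[ x ← allVecs m ] (inBallCount L x t * inBallCount L x t)

crossMoment : ∀ {m} → List (Vec Bool m) → ℕ
crossMoment {m} L = ∑[ t ← upTo (suc m) ] ∑[ x ← allVecs m ] (inBallCount L x t * ballSize x t)

volumeSquares : ℕ → ℕ
volumeSquares m = ∑[ t ← upTo (suc m) ] (volume m t * volume m t)

-- S(L) = Σ_{z,z′ ∈ L} P(z,z′): expand the square and move the pair sum outside.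
secondMoment-pairs : ∀ {m} (L : List (Vec Bool m)) → secondMoment L ≡ ∑[ z ← L ] ∑[ z′ ← L ] pairKernel z z′
secondMoment-pairs {m} L = begin
    secondMoment L
  ≡⟨ ∑-cong (upTo (suc m)) (λ t → ∑-cong (allVecs m) (λ x → square x t)) ⟩
    ∑[ t ← upTo (suc m) ] ∑[ x ← allVecs m ] ∑[ z ← L ] ∑[ z′ ← L ] g t x z z′
  ≡⟨ ∑-swap (upTo (suc m)) (allVecs m) (λ t x → ∑[ z ← L ] ∑[ z′ ← L ] g t x z z′) ⟩
    ∑[ x ← allVecs m ] ∑[ t ← upTo (suc m) ] ∑[ z ← L ] ∑[ z′ ← L ] g t x z z′
  ≡⟨ ∑-cong (allVecs m) (λ x → ∑-into-pairs (upTo (suc m)) L (λ t → g t x)) ⟩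
    ∑[ x ← allVecs m ] ∑[ z ← L ] ∑[ z′ ← L ] ∑[ t ← upTo (suc m) ] g t x z z′
  ≡⟨ ∑-into-pairs (allVecs m) L (λ x z z′ → ∑[ t ← upTo (suc m) ] g t x z z′) ⟩
    ∑[ z ← L ] ∑[ z′ ← L ] pairKernel z z′
  ∎
  where
  open ≡-Reasoning
  g : ℕ → Vec Bool m → Vec Bool m → Vec Bool m → ℕ
  g t x z z′ = 𝟙 (inBall x t z) * 𝟙 (inBall x t z′)
  square : ∀ x t → inBallCount L x t * inBallCount L x t ≡ ∑[ z ← L ] ∑[ z′ ← L ] g t x z z′
  square x t = trans (cong₂ _*_ (length-filter (inBall x t) L) (length-filter (inBall x t) L))
                     (∑-square L (λ z → 𝟙 (inBall x t z)))

secondMoment-extend : ∀ {m} (L : List (Vec Bool m)) →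
  secondMoment (map extend L) ≡ 2 * secondMoment L + length L * (length L * 2 ^ m)
secondMoment-extend {m} L = begin
    secondMoment (map extend L)
  ≡⟨ secondMoment-pairs (map extend L) ⟩
    ∑[ w ← map extend L ] ∑[ w′ ← map extend L ] pairKernel w w′
  ≡⟨ ∑-map extend L _ ⟩
    ∑[ z ← L ] ∑[ w′ ← map extend L ] pairKernel (extend z) w′
  ≡⟨ ∑-cong L (λ z → ∑-map extend L (pairKernel (extend z))) ⟩
    ∑[ z ← L ] ∑[ z′ ← L ] pairKernel (extend z) (extend z′)
  ≡⟨ ∑-cong L (λ z → ∑-cong L (pairKernel-parity-extend z)) ⟩
    ∑[ z ← L ] ∑[ z′ ← L ] (2 * pairKernel z z′ + 2 ^ m)
  ≡⟨ ∑₂-+ L L (λ z z′ → 2 * pairKernel z z′) (λ _ _ → 2 ^ m) ⟩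
    ∑[ z ← L ] ∑[ z′ ← L ] (2 * pairKernel z z′) + ∑[ z ← L ] ∑[ z′ ← L ] (2 ^ m)
  ≡⟨ cong₂ _+_ (∑₂-*ˡ L L 2 pairKernel)
               (trans (∑-cong L (λ _ → ∑-const L (2 ^ m))) (∑-const L _)) ⟩
    2 * ∑[ z ← L ] ∑[ z′ ← L ] pairKernel z z′ + length L * (length L * 2 ^ m)
  ≡⟨ cong (λ s → 2 * s + length L * (length L * 2 ^ m)) (secondMoment-pairs L) ⟨
    2 * secondMoment L + length L * (length L * 2 ^ m)
  ∎
  where open ≡-Reasoning

-- Σ_x c_L(x,t) = |L| V_m(t): each codeword lies in V_m(t) balls of radius t.
∑-inBallCount : ∀ {m} (L : List (Vec Bool m)) t → ∑[ x ← allVecs m ] inBallCount L x t ≡ length L * volume m t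
∑-inBallCount {m} L t = begin
    ∑[ x ← allVecs m ] inBallCount L x t
  ≡⟨ ∑-cong (allVecs m) (λ x → length-filter (inBall x t) L) ⟩
    ∑[ x ← allVecs m ] ∑[ z ← L ] 𝟙 (hamming x z ≤ᵇ t)
  ≡⟨ ∑-swap (allVecs m) L (λ x z → 𝟙 (hamming x z ≤ᵇ t)) ⟩
    ∑[ z ← L ] ∑[ x ← allVecs m ] 𝟙 (hamming x z ≤ᵇ t)
  ≡⟨ ∑-cong L balls-around ⟩
    ∑[ z ← L ] volume m t
  ≡⟨ ∑-const L (volume m t) ⟩
    length L * volume m t
  ∎
  where
  open ≡-Reasoning
  balls-around : ∀ z → ∑[ x ← allVecs m ] 𝟙 (hamming x z ≤ᵇ t) ≡ volume m t
  balls-around z = trans (∑-cong (allVecs m) (λ x → cong (λ d → 𝟙 (d ≤ᵇ t)) (hamming-sym x z)))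
    (trans (sym (length-filter (inBall z t) (allVecs m))) (ballSize≡volume z t))

crossMoment-value : ∀ {m} (L : List (Vec Bool m)) → crossMoment L ≡ length L * volumeSquares m
crossMoment-value {m} L =
  trans (∑-cong (upTo (suc m)) at-radius) (∑-*ˡ (upTo (suc m)) (length L) (λ t → volume m t * volume m t))
  where
  at-radius : ∀ t → ∑[ x ← allVecs m ] (inBallCount L x t * ballSize x t) ≡ length L * (volume m t * volume m t)
  at-radius t = trans (∑-cong (allVecs m) (λ x → cong (inBallCount L x t *_) (ballSize≡volume x t)))
    (trans (∑-*ʳ (allVecs m) (volume m t) (λ x → inBallCount L x t))
      (trans (cong (_* volume m t) (∑-inBallCount L t)) (ℕP.*-assoc (length L) _ _)))

secondMoment-cube : ∀ m → secondMoment (allVecs m) ≡ 2 ^ m * volumeSquares m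
secondMoment-cube m =
  trans (∑-cong (upTo (suc m)) at-radius) (∑-*ˡ (upTo (suc m)) (2 ^ m) (λ t → volume m t * volume m t))
  where
  at-radius : ∀ t → ∑[ x ← allVecs m ] (ballSize x t * ballSize x t) ≡ 2 ^ m * (volume m t * volume m t)
  at-radius t = trans (∑-cong (allVecs m) (λ x → cong₂ _*_ (ballSize≡volume x t) (ballSize≡volume x t)))
    (∑-cube-const m (volume m t * volume m t))

-- The extension identity summed over all pairs of words of length m + 1, split by last bits.
cube-moment-step : ∀ m →
  secondMoment (allVecs (suc m)) + 2 * ∑[ y ← allVecs m ] ∑[ y′ ← allVecs m ] equidistant y y′
    ≡ 8 * secondMoment (allVecs m) + 2 ^ m * (2 ^ m * (4 * 2 ^ m))
cube-moment-step m = begin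
    secondMoment (allVecs (suc m)) + 2 * ∑[ y ← W ] ∑[ y′ ← W ] equidistant y y′
  ≡⟨ cong₂ _+_ (trans (secondMoment-pairs (allVecs (suc m))) (∑-cube-last₂ m pairKernel))
               (sym (∑₂-*ˡ W W 2 equidistant)) ⟩
    ∑[ y ← W ] ∑[ y′ ← W ] X y y′ + ∑[ y ← W ] ∑[ y′ ← W ] (2 * equidistant y y′)
  ≡⟨ ∑₂-+ W W X (λ y y′ → 2 * equidistant y y′) ⟨
    ∑[ y ← W ] ∑[ y′ ← W ] (X y y′ + 2 * equidistant y y′)
  ≡⟨ ∑-cong W (λ y → ∑-cong W (four-extensions y)) ⟩
    ∑[ y ← W ] ∑[ y′ ← W ] (8 * pairKernel y y′ + 4 * 2 ^ m)
  ≡⟨ ∑₂-+ W W (λ y y′ → 8 * pairKernel y y′) (λ _ _ → 4 * 2 ^ m) ⟩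
    ∑[ y ← W ] ∑[ y′ ← W ] (8 * pairKernel y y′) + ∑[ y ← W ] ∑[ y′ ← W ] (4 * 2 ^ m)
  ≡⟨ cong₂ _+_ (trans (∑₂-*ˡ W W 8 pairKernel) (cong (8 *_) (sym (secondMoment-pairs W))))
               (trans (∑-cong W (λ _ → ∑-cube-const m (4 * 2 ^ m))) (∑-cube-const m _)) ⟩
    8 * secondMoment W + 2 ^ m * (2 ^ m * (4 * 2 ^ m))
  ∎
  where
  open ≡-Reasoning
  W = allVecs m
  X : Vec Bool m → Vec Bool m → ℕ
  X y y′ = (pairKernel (y ∷ʳ false) (y′ ∷ʳ false) + pairKernel (y ∷ʳ false) (y′ ∷ʳ true))
         + (pairKernel (y ∷ʳ true) (y′ ∷ʳ false) + pairKernel (y ∷ʳ true) (y′ ∷ʳ true))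

volumeSquares-step : ∀ m → volumeSquares (suc m) + (2 * m) C m ≡ 4 * volumeSquares m + 2 * (2 ^ m * 2 ^ m)
volumeSquares-step m = ℕP.*-cancelˡ-≡ _ _ (2 ^ suc m) {{ℕP.m^n≢0 2 (suc m)}} (begin
    2 ^ suc m * (R′ + B)
  ≡⟨ distribute M R′ B ⟩
    2 ^ suc m * R′ + 2 * (M * B)
  ≡⟨ cong₂ (λ s e → s + 2 * e) (secondMoment-cube (suc m)) (∑-equidistant m) ⟨
    secondMoment (allVecs (suc m)) + 2 * ∑[ y ← allVecs m ] ∑[ y′ ← allVecs m ] equidistant y y′
  ≡⟨ cube-moment-step m ⟩
    8 * secondMoment (allVecs m) + M * (M * (4 * M))
  ≡⟨ cong (λ s → 8 * s + M * (M * (4 * M))) (secondMoment-cube m) ⟩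
    8 * (M * R) + M * (M * (4 * M))
  ≡⟨ factor M R ⟩
    2 ^ suc m * (4 * R + 2 * (M * M))
  ∎)
  where
  open ≡-Reasoning
  M = 2 ^ m
  R = volumeSquares m
  R′ = volumeSquares (suc m)
  B = (2 * m) C m
  distribute : ∀ M R′ B → 2 * M * (R′ + B) ≡ 2 * M * R′ + 2 * (M * B)
  distribute = solve-∀
  factor : ∀ M R → 8 * (M * R) + M * (M * (4 * M)) ≡ 2 * M * (4 * R + 2 * (M * M))
  factor = solve-∀

fromℚᵘ-+ : ∀ p q → fromℚᵘ (p +ᵘ q) ≡ fromℚᵘ p +ℚ fromℚᵘ q
fromℚᵘ-+ p q = ℚP.toℚᵘ-injective (ℚᵘP.≃-trans (ℚP.toℚᵘ-fromℚᵘ (p +ᵘ q))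
  (ℚᵘP.≃-trans (ℚᵘP.+-cong (ℚᵘP.≃-sym (ℚP.toℚᵘ-fromℚᵘ p)) (ℚᵘP.≃-sym (ℚP.toℚᵘ-fromℚᵘ q)))
    (ℚᵘP.≃-sym (ℚP.toℚᵘ-homo-+ (fromℚᵘ p) (fromℚᵘ q)))))

fromℚᵘ-* : ∀ p q → fromℚᵘ (p *ᵘ q) ≡ fromℚᵘ p *ℚ fromℚᵘ q
fromℚᵘ-* p q = ℚP.toℚᵘ-injective (ℚᵘP.≃-trans (ℚP.toℚᵘ-fromℚᵘ (p *ᵘ q))
  (ℚᵘP.≃-trans (ℚᵘP.*-cong (ℚᵘP.≃-sym (ℚP.toℚᵘ-fromℚᵘ p)) (ℚᵘP.≃-sym (ℚP.toℚᵘ-fromℚᵘ q)))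
    (ℚᵘP.≃-sym (ℚP.toℚᵘ-homo-* (fromℚᵘ p) (fromℚᵘ q)))))

-- ι n = n/1 embeds ℕ in ℚ and w n = 1/n is its reciprocal (w 0 = 0, as for frac).  Both are
-- opaque, so that the type checker never unfolds the gcd normalisation hidden in frac.
opaque
  ι : ℕ → ℚ
  ι a = frac a 1

  w : ℕ → ℚ
  w n = frac 1 n

  frac-one : ∀ a → frac a 1 ≡ ι a
  frac-one a = refl

  ι-zero : ι 0 ≡ 0ℚ
  ι-zero = refl

  ι-+ : ∀ a b → ι (a + b) ≡ ι a +ℚ ι b
  ι-+ a b = trans (ℚP.fromℚᵘ-cong {mkℚᵘ (ℤ.+ (a + b)) 0} {mkℚᵘ (ℤ.+ a) 0 +ᵘ mkℚᵘ (ℤ.+ b) 0} (*≡* same))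
                  (fromℚᵘ-+ (mkℚᵘ (ℤ.+ a) 0) (mkℚᵘ (ℤ.+ b) 0))
    where
    same : ℤ.+ (a + b) ℤ.* ℤ.+ 1 ≡ (ℤ.+ a ℤ.* ℤ.+ 1 ℤ.+ ℤ.+ b ℤ.* ℤ.+ 1) ℤ.* ℤ.+ 1
    same rewrite ℤP.*-identityʳ (ℤ.+ (a + b)) | ℤP.*-identityʳ (ℤ.+ a) | ℤP.*-identityʳ (ℤ.+ b)
               | ℤP.*-identityʳ (ℤ.+ a ℤ.+ ℤ.+ b) = ℤP.pos-+ a b

  ι-* : ∀ a b → ι (a * b) ≡ ι a *ℚ ι b
  ι-* a b = trans (ℚP.fromℚᵘ-cong {mkℚᵘ (ℤ.+ (a * b)) 0} {mkℚᵘ (ℤ.+ a) 0 *ᵘ mkℚᵘ (ℤ.+ b) 0}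
                    (*≡* (cong (ℤ._* ℤ.+ 1) (ℤP.pos-* a b))))
                  (fromℚᵘ-* (mkℚᵘ (ℤ.+ a) 0) (mkℚᵘ (ℤ.+ b) 0))

  frac-split : ∀ a n → frac a n ≡ ι a *ℚ w n
  frac-split a zero = sym (ℚP.*-zeroʳ (ι a))
  frac-split a (suc b) = trans (ℚP.fromℚᵘ-cong {mkℚᵘ (ℤ.+ a) b} {mkℚᵘ (ℤ.+ a) 0 *ᵘ mkℚᵘ (ℤ.+ 1) b} (*≡* same))
                               (fromℚᵘ-* (mkℚᵘ (ℤ.+ a) 0) (mkℚᵘ (ℤ.+ 1) b))
    where
    same : ℤ.+ a ℤ.* ℤ.+ (1 * suc b) ≡ (ℤ.+ a ℤ.* ℤ.+ 1) ℤ.* ℤ.+ (suc b)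
    same rewrite ℕP.*-identityˡ (suc b) | ℤP.*-identityʳ (ℤ.+ a) = refl

  w-* : ∀ a b .{{_ : NonZero a}} .{{_ : NonZero b}} → w (a * b) ≡ w a *ℚ w b
  w-* (suc a) (suc b) = trans (ℚP.fromℚᵘ-cong {mkℚᵘ (ℤ.+ 1) (b + a * suc b)} {mkℚᵘ (ℤ.+ 1) a *ᵘ mkℚᵘ (ℤ.+ 1) b} (*≡* refl))
                              (fromℚᵘ-* (mkℚᵘ (ℤ.+ 1) a) (mkℚᵘ (ℤ.+ 1) b))

  ι-w-inverse : ∀ n .{{_ : NonZero n}} → ι n *ℚ w n ≡ 1ℚ
  ι-w-inverse (suc b) = trans (sym (frac-split (suc b) (suc b)))
    (ℚP.fromℚᵘ-cong {mkℚᵘ (ℤ.+ suc b) b} {mkℚᵘ (ℤ.+ 1) 0} (*≡* (ℤP.*-comm (ℤ.+ suc b) (ℤ.+ 1))))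

ℚ-ring : AlmostCommutativeRing _ _
ℚ-ring = fromCommutativeRing ℚP.+-*-commutativeRing (λ x → dec⇒maybe (0ℚ ℚP.≟ x))

sumℚ-cong : ∀ {A : Set} (xs : List A) {f g : A → ℚ} → (∀ x → f x ≡ g x) → sumℚ (map f xs) ≡ sumℚ (map g xs)
sumℚ-cong xs f≗g = cong sumℚ (ListP.map-cong f≗g xs)

-- The expanded square a²α − 2abβ ℤ.+ b²γ of a·(1/N) − b·(1/M), with α = 1/N², β = 1/(NM), γ = 1/M².
quad : ℚ → ℚ → ℚ → ℚ → ℚ → ℚ → ℚ
quad α β γ a² ab b² = a² *ℚ α -ℚ ab *ℚ β -ℚ ab *ℚ β +ℚ b² *ℚ γ

quad-cong : ∀ α β γ {a b c a′ b′ c′} → a ≡ a′ → b ≡ b′ → c ≡ c′ → quad α β γ a b c ≡ quad α β γ a′ b′ c′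
quad-cong α β γ refl refl refl = refl

square-expand : ∀ a b N M → (frac a N -ℚ frac b M) *ℚ (frac a N -ℚ frac b M)
  ≡ quad (w N *ℚ w N) (w N *ℚ w M) (w M *ℚ w M) (ι (a * a)) (ι (a * b)) (ι (b * b))
square-expand a b N M
  rewrite frac-split a N | frac-split b M | ι-* a a | ι-* a b | ι-* b b = expand (ι a) (ι b) (w N) (w M)
  where
  expand : ∀ a b u v → (a *ℚ u -ℚ b *ℚ v) *ℚ (a *ℚ u -ℚ b *ℚ v)
    ≡ (a *ℚ a) *ℚ (u *ℚ u) -ℚ (a *ℚ b) *ℚ (u *ℚ v) -ℚ (a *ℚ b) *ℚ (u *ℚ v) +ℚ (b *ℚ b) *ℚ (v *ℚ v)
  expand = solveℚ-∀ ℚ-ring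

-- The quadratic form is linear in its last three arguments, so it commutes with summation.
sumℚ-quad : ∀ {A : Set} (xs : List A) (f g h : A → ℕ) α β γ →
  sumℚ (map (λ x → quad α β γ (ι (f x)) (ι (g x)) (ι (h x))) xs) ≡ quad α β γ (ι (∑ xs f)) (ι (∑ xs g)) (ι (∑ xs h))
sumℚ-quad [] f g h α β γ = trans (vanish α β γ) (quad-cong α β γ (sym ι-zero) (sym ι-zero) (sym ι-zero))
  where
  vanish : ∀ α β γ → 0ℚ ≡ 0ℚ *ℚ α -ℚ 0ℚ *ℚ β -ℚ 0ℚ *ℚ β +ℚ 0ℚ *ℚ γ
  vanish = solveℚ-∀ ℚ-ring
sumℚ-quad (x ∷ xs) f g h α β γ = begin
    quad α β γ (ι (f x)) (ι (g x)) (ι (h x)) +ℚ sumℚ (map (λ x → quad α β γ (ι (f x)) (ι (g x)) (ι (h x))) xs)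
  ≡⟨ cong (quad α β γ (ι (f x)) (ι (g x)) (ι (h x)) +ℚ_) (sumℚ-quad xs f g h α β γ) ⟩
    quad α β γ (ι (f x)) (ι (g x)) (ι (h x)) +ℚ quad α β γ (ι (∑ xs f)) (ι (∑ xs g)) (ι (∑ xs h))
  ≡⟨ additive α β γ (ι (f x)) (ι (g x)) (ι (h x)) (ι (∑ xs f)) (ι (∑ xs g)) (ι (∑ xs h)) ⟩
    quad α β γ (ι (f x) +ℚ ι (∑ xs f)) (ι (g x) +ℚ ι (∑ xs g)) (ι (h x) +ℚ ι (∑ xs h))
  ≡⟨ quad-cong α β γ (ι-+ (f x) (∑ xs f)) (ι-+ (g x) (∑ xs g)) (ι-+ (h x) (∑ xs h)) ⟨
    quad α β γ (ι (f x + ∑ xs f)) (ι (g x + ∑ xs g)) (ι (h x + ∑ xs h))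
  ∎
  where
  open ≡-Reasoning
  additive : ∀ α β γ a b c a′ b′ c′ →
    (a *ℚ α -ℚ b *ℚ β -ℚ b *ℚ β +ℚ c *ℚ γ) +ℚ (a′ *ℚ α -ℚ b′ *ℚ β -ℚ b′ *ℚ β +ℚ c′ *ℚ γ)
      ≡ (a +ℚ a′) *ℚ α -ℚ (b +ℚ b′) *ℚ β -ℚ (b +ℚ b′) *ℚ β +ℚ (c +ℚ c′) *ℚ γ
  additive = solveℚ-∀ ℚ-ring

DL2-expand : ∀ {m} (L : List (Vec Bool m)) → DL2 L ≡
  quad (w (length L) *ℚ w (length L)) (w (length L) *ℚ w (2 ^ m)) (w (2 ^ m) *ℚ w (2 ^ m))
       (ι (secondMoment L)) (ι (crossMoment L)) (ι (secondMoment (allVecs m)))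
DL2-expand {m} L = trans
  (sumℚ-cong (upTo (suc m)) (λ t → trans
    (sumℚ-cong (allVecs m) (λ x → square-expand (c x t) (V x t) N M))
    (sumℚ-quad (allVecs m) (λ x → c x t * c x t) (λ x → c x t * V x t) (λ x → V x t * V x t) α β γ)))
  (sumℚ-quad (upTo (suc m)) (λ t → ∑[ x ← allVecs m ] (c x t * c x t)) (λ t → ∑[ x ← allVecs m ] (c x t * V x t))
    (λ t → ∑[ x ← allVecs m ] (V x t * V x t)) α β γ)
  where
  N = length L
  M = 2 ^ m
  α = w N *ℚ w N
  β = w N *ℚ w M
  γ = w M *ℚ w M
  c : Vec Bool m → ℕ → ℕ
  c = inBallCount L
  V : Vec Bool m → ℕ → ℕ
  V = ballSize

quad-collapse : ∀ s n wn r M wM → n *ℚ wn ≡ 1ℚ → M *ℚ wM ≡ 1ℚ →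
  quad (wn *ℚ wn) (wn *ℚ wM) (wM *ℚ wM) s (n *ℚ r) (M *ℚ r) ≡ s *ℚ (wn *ℚ wn) -ℚ r *ℚ wM
quad-collapse s n wn r M wM n-inv M-inv = begin
    quad (wn *ℚ wn) (wn *ℚ wM) (wM *ℚ wM) s (n *ℚ r) (M *ℚ r)
  ≡⟨ regroup s n wn r M wM ⟩
    s *ℚ (wn *ℚ wn) -ℚ r *ℚ wM *ℚ (n *ℚ wn) -ℚ r *ℚ wM *ℚ (n *ℚ wn) +ℚ r *ℚ wM *ℚ (M *ℚ wM)
  ≡⟨ cong₂ (λ p q → s *ℚ (wn *ℚ wn) -ℚ r *ℚ wM *ℚ p -ℚ r *ℚ wM *ℚ p +ℚ r *ℚ wM *ℚ q) n-inv M-inv ⟩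
    s *ℚ (wn *ℚ wn) -ℚ r *ℚ wM *ℚ 1ℚ -ℚ r *ℚ wM *ℚ 1ℚ +ℚ r *ℚ wM *ℚ 1ℚ
  ≡⟨ simplify (s *ℚ (wn *ℚ wn)) (r *ℚ wM) ⟩
    s *ℚ (wn *ℚ wn) -ℚ r *ℚ wM
  ∎
  where
  open ≡-Reasoning
  regroup : ∀ s n wn r M wM →
    s *ℚ (wn *ℚ wn) -ℚ (n *ℚ r) *ℚ (wn *ℚ wM) -ℚ (n *ℚ r) *ℚ (wn *ℚ wM) +ℚ (M *ℚ r) *ℚ (wM *ℚ wM)
      ≡ s *ℚ (wn *ℚ wn) -ℚ r *ℚ wM *ℚ (n *ℚ wn) -ℚ r *ℚ wM *ℚ (n *ℚ wn) +ℚ r *ℚ wM *ℚ (M *ℚ wM)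
  regroup = solveℚ-∀ ℚ-ring
  simplify : ∀ x y → x -ℚ y *ℚ 1ℚ -ℚ y *ℚ 1ℚ +ℚ y *ℚ 1ℚ ≡ x -ℚ y
  simplify = solveℚ-∀ ℚ-ring

DL2-closed : ∀ {m} (L : List (Vec Bool m)) {N} .{{_ : NonZero N}} → length L ≡ N →
  DL2 L ≡ ι (secondMoment L) *ℚ (w N *ℚ w N) -ℚ ι (volumeSquares m) *ℚ w (2 ^ m)
DL2-closed {m} L {N} refl = begin
    DL2 L
  ≡⟨ DL2-expand L ⟩
    quad (w N *ℚ w N) (w N *ℚ w M) (w M *ℚ w M) (ι (secondMoment L)) (ι (crossMoment L)) (ι (secondMoment (allVecs m)))
  ≡⟨ cong₂ (quad (w N *ℚ w N) (w N *ℚ w M) (w M *ℚ w M) (ι (secondMoment L)))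
           (trans (cong ι (crossMoment-value L)) (ι-* N R)) (trans (cong ι (secondMoment-cube m)) (ι-* M R)) ⟩
    quad (w N *ℚ w N) (w N *ℚ w M) (w M *ℚ w M) (ι (secondMoment L)) (ι N *ℚ ι R) (ι M *ℚ ι R)
  ≡⟨ quad-collapse (ι (secondMoment L)) (ι N) (w N) (ι R) (ι M) (w M)
       (ι-w-inverse N) (ι-w-inverse M {{ℕP.m^n≢0 2 m}}) ⟩
    ι (secondMoment L) *ℚ (w N *ℚ w N) -ℚ ι R *ℚ w M
  ∎
  where
  open ≡-Reasoning
  M = 2 ^ m
  R = volumeSquares m

extension-algebra : ∀ s r r′ c n wn M wM two wTwo →
  n *ℚ wn ≡ 1ℚ → M *ℚ wM ≡ 1ℚ → two *ℚ wTwo ≡ 1ℚ → r′ +ℚ c ≡ two *ℚ two *ℚ r +ℚ two *ℚ (M *ℚ M) →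
  (two *ℚ s +ℚ n *ℚ (n *ℚ M)) *ℚ (wn *ℚ wn) -ℚ r′ *ℚ (wTwo *ℚ wM)
    ≡ two *ℚ (s *ℚ (wn *ℚ wn) -ℚ r *ℚ wM) +ℚ c *ℚ (wTwo *ℚ wM)
extension-algebra s r r′ c n wn M wM two wTwo n-inv M-inv two-inv volume-step = begin
    (two *ℚ s +ℚ n *ℚ (n *ℚ M)) *ℚ (wn *ℚ wn) -ℚ r′ *ℚ (wTwo *ℚ wM)
  ≡⟨ isolate s r′ c n wn M wM two wTwo ⟩
    (two *ℚ s +ℚ n *ℚ (n *ℚ M)) *ℚ (wn *ℚ wn) -ℚ (r′ +ℚ c) *ℚ (wTwo *ℚ wM) +ℚ c *ℚ (wTwo *ℚ wM)
  ≡⟨ cong (λ q → (two *ℚ s +ℚ n *ℚ (n *ℚ M)) *ℚ (wn *ℚ wn) -ℚ q *ℚ (wTwo *ℚ wM) +ℚ c *ℚ (wTwo *ℚ wM)) volume-step ⟩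
    (two *ℚ s +ℚ n *ℚ (n *ℚ M)) *ℚ (wn *ℚ wn) -ℚ (two *ℚ two *ℚ r +ℚ two *ℚ (M *ℚ M)) *ℚ (wTwo *ℚ wM)
      +ℚ c *ℚ (wTwo *ℚ wM)
  ≡⟨ regroup s r c n wn M wM two wTwo ⟩
    E (n *ℚ wn) (M *ℚ wM) (two *ℚ wTwo)
  ≡⟨ cong₂ (λ p q → E p q (two *ℚ wTwo)) n-inv M-inv ⟩
    E 1ℚ 1ℚ (two *ℚ wTwo)
  ≡⟨ cong (E 1ℚ 1ℚ) two-inv ⟩
    E 1ℚ 1ℚ 1ℚ
  ≡⟨ simplify s r c wn M wM two wTwo ⟩
    two *ℚ (s *ℚ (wn *ℚ wn) -ℚ r *ℚ wM) +ℚ c *ℚ (wTwo *ℚ wM)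
  ∎
  where
  open ≡-Reasoning
  E : ℚ → ℚ → ℚ → ℚ
  E p q u = two *ℚ s *ℚ (wn *ℚ wn) +ℚ M *ℚ (p *ℚ p) -ℚ two *ℚ r *ℚ wM *ℚ u -ℚ M *ℚ q *ℚ u +ℚ c *ℚ (wTwo *ℚ wM)
  isolate : ∀ s r′ c n wn M wM two wTwo →
    (two *ℚ s +ℚ n *ℚ (n *ℚ M)) *ℚ (wn *ℚ wn) -ℚ r′ *ℚ (wTwo *ℚ wM)
      ≡ (two *ℚ s +ℚ n *ℚ (n *ℚ M)) *ℚ (wn *ℚ wn) -ℚ (r′ +ℚ c) *ℚ (wTwo *ℚ wM) +ℚ c *ℚ (wTwo *ℚ wM)
  isolate = solveℚ-∀ ℚ-ring
  regroup : ∀ s r c n wn M wM two wTwo →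
    (two *ℚ s +ℚ n *ℚ (n *ℚ M)) *ℚ (wn *ℚ wn) -ℚ (two *ℚ two *ℚ r +ℚ two *ℚ (M *ℚ M)) *ℚ (wTwo *ℚ wM)
      +ℚ c *ℚ (wTwo *ℚ wM)
      ≡ two *ℚ s *ℚ (wn *ℚ wn) +ℚ M *ℚ ((n *ℚ wn) *ℚ (n *ℚ wn)) -ℚ two *ℚ r *ℚ wM *ℚ (two *ℚ wTwo)
          -ℚ M *ℚ (M *ℚ wM) *ℚ (two *ℚ wTwo) +ℚ c *ℚ (wTwo *ℚ wM)
  regroup = solveℚ-∀ ℚ-ring
  simplify : ∀ s r c wn M wM two wTwo →
    two *ℚ s *ℚ (wn *ℚ wn) +ℚ M *ℚ (1ℚ *ℚ 1ℚ) -ℚ two *ℚ r *ℚ wM *ℚ 1ℚ -ℚ M *ℚ 1ℚ *ℚ 1ℚ +ℚ c *ℚ (wTwo *ℚ wM)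
      ≡ two *ℚ (s *ℚ (wn *ℚ wn) -ℚ r *ℚ wM) +ℚ c *ℚ (wTwo *ℚ wM)
  simplify = solveℚ-∀ ℚ-ring

DL2-extend : ∀ {m} (L : List (Vec Bool m)) .{{_ : NonZero (length L)}} →
  DL2 (extendedCode L) ≡ frac 2 1 *ℚ DL2 L +ℚ frac ((2 * m) C m) (2 ^ suc m)
DL2-extend {m} L = begin
    DL2 (map extend L)
  ≡⟨ DL2-closed (map extend L) (ListP.length-map extend L) ⟩
    ι (secondMoment (map extend L)) *ℚ (w N *ℚ w N) -ℚ ι R′ *ℚ w (2 * M)
  ≡⟨ cong₂ (λ s v → s *ℚ (w N *ℚ w N) -ℚ ι R′ *ℚ v) S′-value (w-* 2 M) ⟩
    (ι 2 *ℚ ι S +ℚ ι N *ℚ (ι N *ℚ ι M)) *ℚ (w N *ℚ w N) -ℚ ι R′ *ℚ (w 2 *ℚ w M)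
  ≡⟨ extension-algebra (ι S) (ι R) (ι R′) (ι B) (ι N) (w N) (ι M) (w M) (ι 2) (w 2)
       (ι-w-inverse N) (ι-w-inverse M) (ι-w-inverse 2) R′-value ⟩
    ι 2 *ℚ (ι S *ℚ (w N *ℚ w N) -ℚ ι R *ℚ w M) +ℚ ι B *ℚ (w 2 *ℚ w M)
  ≡⟨ cong₂ (λ d v → ι 2 *ℚ d +ℚ ι B *ℚ v) (DL2-closed L refl) (w-* 2 M) ⟨
    ι 2 *ℚ DL2 L +ℚ ι B *ℚ w (2 ^ suc m)
  ≡⟨ cong₂ (λ two b → two *ℚ DL2 L +ℚ b) (frac-one 2) (frac-split B (2 ^ suc m)) ⟨
    frac 2 1 *ℚ DL2 L +ℚ frac B (2 ^ suc m)
  ∎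
  where
  open ≡-Reasoning
  N = length L
  M = 2 ^ m
  S = secondMoment L
  R = volumeSquares m
  R′ = volumeSquares (suc m)
  B = (2 * m) C m
  instance
    M≢0 : NonZero M
    M≢0 = ℕP.m^n≢0 2 m
  S′-value : ι (secondMoment (map extend L)) ≡ ι 2 *ℚ ι S +ℚ ι N *ℚ (ι N *ℚ ι M)
  S′-value = trans (cong ι (secondMoment-extend L))
    (trans (ι-+ (2 * S) (N * (N * M)))
      (cong₂ _+ℚ_ (ι-* 2 S) (trans (ι-* N (N * M)) (cong (ι N *ℚ_) (ι-* N M)))))
  R′-value : ι R′ +ℚ ι B ≡ ι 2 *ℚ ι 2 *ℚ ι R +ℚ ι 2 *ℚ (ι M *ℚ ι M)
  R′-value = trans (sym (ι-+ R′ B)) (trans (cong ι (volumeSquares-step m))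
    (trans (ι-+ (4 * R) (2 * (M * M)))
      (cong₂ _+ℚ_ (trans (ι-* 4 R) (cong (_*ℚ ι R) (ι-* 2 2)))
                  (trans (ι-* 2 (M * M)) (cong (ι 2 *ℚ_) (ι-* M M))))))

codewords-nonempty : ∀ {m} (Z : Vec Bool m → Bool) → IsLinearCode Z → NonZero (length (codewords Z))
codewords-nonempty {m} Z linear = >-nonZero (begin
    1                                 ≡⟨ cong 𝟙 (IsLinearCode.has-zero linear) ⟨
    𝟙 (Z (replicate m false))         ≤⟨ term≤∑-cube (replicate m false) (𝟙 ∘ Z) ⟩
    ∑[ y ← allVecs m ] 𝟙 (Z y)        ≡⟨ length-filter Z (allVecs m) ⟨
    length (codewords Z)              ∎)
  where open ℕP.≤-Reasoning

proposition3p5 : (p n : ℕ) → 1 ≤ p → n ≡ 2 * p ∸ 1 →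
    (Z : Vec Bool n → Bool) → IsLinearCode Z →
    DL2 (extendedCode (codewords Z))
      ≡ frac 2 1 *ℚ DL2 (codewords Z) +ℚ frac ((2 * n) C n) (2 ^ suc n)
proposition3p5 p n _ _ Z linear = DL2-extend (codewords Z) {{codewords-nonempty Z linear}}
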